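{- For any complete graph $K_r$ ($r\ge 1$) and any path graph $P_t$ ($t\ge 1$), $$\gamma_o(K_{r}\Box P_{t})\ge \gamma_o(K_r)\gamma_o(P_t).$$
   Context: All graphs are finite and simple; $K_r$ is the complete graph on $r$ vertices and $P_t$ the path on $t$ vertices. For a graph with vertex set $V$, a vertex $v$ and $S\subseteq V$, let $\delta_S(v)=|N(v)\cap S|$ and $\overline{S}=V\setminus S$. A nonempty set $S\subseteq V$ is a global offensive alliance if $\delta_S(v)\ge \delta_{\overline{S}}(v)+1$ for every $v\in\overline{S}$; $\gamma_o(G)$ is the minimum cardinality of a global offensive alliance of $G$. $G\Box H$ is the Cartesian product: vertex set $V(G)\times V(H)$, with $(a,b)\sim(c,d)$ iff ($a=c$ and $b\sim d$ in $H$) or ($a\sim c$ in $G$ and $b=d$). -}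

module Defs where

open import Data.Nat using (ℕ; zero; suc; _+_; _*_; _≤_; _<_)
open import Data.Nat using (_≡ᵇ_)
open import Data.Nat.ListAction using (sum)
open import Relation.Nullary using (yes; no)
open import Data.Empty using (⊥-elim)
open import Relation.Binary.PropositionalEquality using (refl; cong; sym)
open import Data.Bool using (Bool; true; false; _∧_; _∨_; not; if_then_else_)
open import Data.Fin using (Fin; toℕ; combine; remQuot)
open import Data.Fin.Properties using (_≟_)
open import Data.Fin.Subset using (Subset; ∁; ∣_∣; Nonempty)
open import Data.Vec using (lookup)
open import Data.List using (List; map; allFin)
open import Data.Product using (_×_; _,_)
open import Relation.Nullary.Decidable using (⌊_⌋)
open import Relation.Binary.PropositionalEquality using (_≡_)

record Graph : Set where
  field
    n      : ℕ
    adj    : Fin n → Fin n → Bool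
    adj-sym : ∀ u v → adj u v ≡ adj v u
    irrefl : ∀ v → adj v v ≡ false
open Graph public

δ : (G : Graph) → Subset (n G) → Fin (n G) → ℕ
δ G S v = sum (map (λ u → if lookup S u ∧ adj G v u then 1 else 0) (allFin (n G)))

IsGOA : (G : Graph) → Subset (n G) → Set
IsGOA G S = Nonempty S ×
  (∀ v → lookup S v ≡ false → δ G (∁ S) v + 1 ≤ δ G S v)

IsGammaO : Graph → ℕ → Set
IsGammaO G k = (Data.Product.Σ (Subset (n G)) λ S → IsGOA G S × ∣ S ∣ ≡ k)
             × (∀ S → IsGOA G S → k ≤ ∣ S ∣)

absDiff : ℕ → ℕ → ℕ
absDiff zero m = m
absDiff (suc a) zero = suc a
absDiff (suc a) (suc b) = absDiff a b

private
  neq-sym : ∀ {m} (i j : Fin m) → not ⌊ i ≟ j ⌋ ≡ not ⌊ j ≟ i ⌋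
  neq-sym i j with i ≟ j | j ≟ i
  ... | yes _ | yes _ = refl
  ... | no _ | no _ = refl
  ... | yes p | no q = ⊥-elim (q (sym p))
  ... | no p | yes q = ⊥-elim (p (sym q))
  neq-irr : ∀ {m} (i : Fin m) → not ⌊ i ≟ i ⌋ ≡ false
  neq-irr i with i ≟ i
  ... | yes _ = refl
  ... | no p = ⊥-elim (p refl)
  absDiff-sym : ∀ a b → absDiff a b ≡ absDiff b a
  absDiff-sym zero zero = refl
  absDiff-sym zero (suc b) = refl
  absDiff-sym (suc a) zero = refl
  absDiff-sym (suc a) (suc b) = absDiff-sym a b
  absDiff-irr : ∀ a → absDiff a a ≡ 0
  absDiff-irr zero = refl
  absDiff-irr (suc a) = absDiff-irr a

K : ℕ → Graph
K r = record
  { n = r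
  ; adj = λ i j → not ⌊ i ≟ j ⌋
  ; adj-sym = neq-sym
  ; irrefl = neq-irr }

P : ℕ → Graph
P t = record
  { n = t
  ; adj = λ i j → absDiff (toℕ i) (toℕ j) ≡ᵇ 1
  ; adj-sym = λ i j → cong (_≡ᵇ 1) (absDiff-sym (toℕ i) (toℕ j))
  ; irrefl = λ i → cong (_≡ᵇ 1) (absDiff-irr (toℕ i)) }

-- Cartesian product G □ H on Fin (n G * n H); vertex (a , b) is
-- encoded as combine a b, decoded by remQuot.
module ProductHelpers where
  eqsym : ∀ {m} (i j : Fin m) → ⌊ i ≟ j ⌋ ≡ ⌊ j ≟ i ⌋
  eqsym i j with i ≟ j | j ≟ i
  ... | yes _ | yes _ = refl
  ... | no _ | no _ = refl
  ... | yes p | no q = ⊥-elim (q (sym p))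
  ... | no p | yes q = ⊥-elim (p (sym q))

  pAdj : (G H : Graph) → Fin (n G) × Fin (n H) → Fin (n G) × Fin (n H) → Bool
  pAdj G H (a , b) (c , d) = (⌊ a ≟ c ⌋ ∧ adj H b d) ∨ (adj G a c ∧ ⌊ b ≟ d ⌋)

  pSym : (G H : Graph) → ∀ p q → pAdj G H p q ≡ pAdj G H q p
  pSym G H (a , b) (c , d)
    rewrite eqsym a c | adj-sym H b d | adj-sym G a c | eqsym b d = refl

  pIrr : (G H : Graph) → ∀ p → pAdj G H p p ≡ false
  pIrr G H (a , b) rewrite irrefl H b | irrefl G a = lem (⌊ a ≟ a ⌋) (⌊ b ≟ b ⌋)
    where
    lem : ∀ p q → (p ∧ false) ∨ (false ∧ q) ≡ false
    lem false q = refl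
    lem true q = refl

  □adj : (G H : Graph) → Fin (n G * n H) → Fin (n G * n H) → Bool
  □adj G H x y = pAdj G H (remQuot {n G} (n H) x) (remQuot {n G} (n H) y)

open ProductHelpers public

_□_ : Graph → Graph → Graph
G □ H = record
  { n = n G * n H
  ; adj = □adj G H
  ; adj-sym = λ x y → pSym G H (remQuot {n G} (n H) x) (remQuot {n G} (n H) y)
  ; irrefl = λ x → pIrr G H (remQuot {n G} (n H) x) }

-- A global offensive alliance S of K_r □ P_t contains at least ⌈r/2⌉ vertices
-- of any two consecutive copies K_r × {b}, K_r × {b+1}. Either the two copies
-- together already cover every column a, or some column a misses both; then
-- (a, b) ∉ S has at most one path-neighbour in S but at least one outside, so
-- the alliance condition at (a, b) forces the copy b alone to contain half of
-- K_r. Summing over ⌊t/2⌋ disjoint pairs gives |S| ≥ ⌊t/2⌋⌈r/2⌉, and for t = 1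
-- the same argument applies to the single copy. On the other side, any ⌈r/2⌉
-- vertices of K_r and the odd vertices of P_t (t ≥ 2) are global offensive
-- alliances, so γ_o(K_r) ≤ ⌈r/2⌉ and γ_o(P_t) ≤ ⌊t/2⌋.
module Submission where

open import Defs
open import Data.Nat using (ℕ; zero; suc; _+_; _*_; _∸_; _≤_; _<_; z≤n; s≤s; _≡ᵇ_; _<ᵇ_; ⌊_/2⌋; ⌈_/2⌉)
open import Data.Nat.Properties
  using (+-0-commutativeMonoid; ≤-refl; ≤-trans; ≤-reflexive; +-mono-≤; +-monoʳ-≤; +-monoˡ-≤; m≤m+n; m≤n+m;
         +-identityʳ; +-assoc; <-irrefl; +-cancelˡ-≤; +-cancelʳ-≤; m+[n∸m]≡n; m+n∸n≡m; m+n≡0⇒m≡0; *-mono-≤; *-comm; *-identityʳ;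
         ⌈n/2⌉-mono; n≡⌈n+n/2⌉; ⌊n/2⌋+⌈n/2⌉≡n; ⌊n/2⌋≤⌈n/2⌉; ⌈n/2⌉≤n; module ≤-Reasoning)
import Data.Nat.ListAction as List
open import Data.Bool using (Bool; true; false; _∧_; _∨_; not; if_then_else_)
open import Data.Bool.Properties using (∧-zeroʳ; ∧-identityʳ; ∧-comm; not-involutive; ∨-idem; ¬-not)
import Data.Bool as Bool
open import Data.Fin using (Fin; zero; suc; toℕ; combine; _↑ˡ_; _↑ʳ_; punchIn; inject₁)
open import Data.Fin.Properties using (_≟_; remQuot-combine; punchInᵢ≢i; any?; toℕ-inject₁)
open import Data.Fin.Subset using (Subset; ∁; ∣_∣; Nonempty; ⊤)
open import Data.Fin.Subset.Properties using (nonempty?; Empty-unique; ∣⊥∣≡0; ∣⊤∣≡n; ∣∁p∣≡n∸∣p∣; ∣p∣≤n; ∈⊤)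
open import Data.Vec using ([]; _∷_; lookup; tabulate)
open import Data.Vec.Properties using (lookup∘tabulate; lookup-replicate; tabulate-cong; tabulate-∘)
open import Data.List.Properties using (map-tabulate)
import Data.List as L
open import Data.Product using (_×_; _,_; proj₂)
open import Function using (_∘_)
open import Relation.Nullary using (¬_; yes; no; contradiction; _×-dec_)
open import Relation.Nullary.Decidable using (⌊_⌋; isYes≗does; dec-true; dec-false)
open import Relation.Binary.PropositionalEquality hiding ([_])
open import Algebra.Properties.CommutativeMonoid.Sum +-0-commutativeMonoid
  using (sum; sum-syntax; sum-remove; sum-cong-≗; sum-replicate-zero; ∑-distrib-+; ∑-comm)

[_] : Bool → ℕ
[ b ] = if b then 1 else 0

⌊≟⌋-refl : ∀ {n} (i : Fin n) → ⌊ i ≟ i ⌋ ≡ true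
⌊≟⌋-refl i = trans (isYes≗does (i ≟ i)) (dec-true (i ≟ i) refl)

⌊≟⌋-≢ : ∀ {n} {i j : Fin n} → i ≢ j → ⌊ i ≟ j ⌋ ≡ false
⌊≟⌋-≢ {i = i} {j} i≢j = trans (isYes≗does (i ≟ j)) (dec-false (i ≟ j) i≢j)

∑-mono-≤ : ∀ {n} {f g : Fin n → ℕ} → (∀ i → f i ≤ g i) → ∑[ i < n ] f i ≤ ∑[ i < n ] g i
∑-mono-≤ {zero}  f≤g = z≤n
∑-mono-≤ {suc n} f≤g = +-mono-≤ (f≤g zero) (∑-mono-≤ (f≤g ∘ suc))

f≤∑f : ∀ {n} (f : Fin n → ℕ) i → f i ≤ ∑[ j < n ] f j
f≤∑f f zero    = m≤m+n _ _
f≤∑f f (suc i) = ≤-trans (f≤∑f (f ∘ suc) i) (m≤n+m _ _)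

∑-const-1 : ∀ n → ∑[ i < n ] 1 ≡ n
∑-const-1 zero    = refl
∑-const-1 (suc n) = cong suc (∑-const-1 n)

∑-single : ∀ {n} (f : Fin n → ℕ) j → (∀ i → i ≢ j → f i ≡ 0) → ∑[ i < n ] f i ≡ f j
∑-single {suc n} f j f≡0 = begin
  sum f                                   ≡⟨ sum-remove {i = j} f ⟩
  f j + sum (f ∘ punchIn j)               ≡⟨ cong (f j +_) (sum-cong-≗ {n} (λ i → f≡0 _ (punchInᵢ≢i j i))) ⟩
  f j + ∑[ i < n ] 0                      ≡⟨ cong (f j +_) (sum-replicate-zero n) ⟩
  f j + 0                                 ≡⟨ +-identityʳ (f j) ⟩
  f j                                     ∎
  where open ≡-Reasoning

∑-select : ∀ {n} (p : Fin n → Bool) (q : Fin n → Bool) j →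
           ∑[ i < n ] [ p i ∧ (⌊ j ≟ i ⌋ ∧ q i) ] ≡ [ p j ∧ q j ]
∑-select p q j = trans (∑-single _ j off-j) (cong (λ e → [ p j ∧ (e ∧ q j) ]) (⌊≟⌋-refl j))
  where
  off-j : ∀ i → i ≢ j → [ p i ∧ (⌊ j ≟ i ⌋ ∧ q i) ] ≡ 0
  off-j i i≢j rewrite ⌊≟⌋-≢ (i≢j ∘ sym) | ∧-zeroʳ (p i) = refl

∑-split : ∀ m {n} (f : Fin (m + n) → ℕ) →
          ∑[ x < m + n ] f x ≡ ∑[ i < m ] f (i ↑ˡ n) + ∑[ j < n ] f (m ↑ʳ j)
∑-split zero    f = refl
∑-split (suc m) f = trans (cong (f zero +_) (∑-split m (f ∘ suc))) (sym (+-assoc (f zero) _ _))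

∑-combine : ∀ m {n} (f : Fin (m * n) → ℕ) →
            ∑[ x < m * n ] f x ≡ ∑[ i < m ] ∑[ j < n ] f (combine i j)
∑-combine zero    f = refl
∑-combine (suc m) {n} f =
  trans (∑-split n f) (cong (∑[ j < n ] f (j ↑ˡ m * n) +_) (∑-combine m (f ∘ (n ↑ʳ_))))

sum-tabulate : ∀ n (f : Fin n → ℕ) → List.sum (L.tabulate f) ≡ ∑[ i < n ] f i
sum-tabulate zero    f = refl
sum-tabulate (suc n) f = cong (f zero +_) (sum-tabulate n (f ∘ suc))

∑-[toℕ≡ᵇ]≤1 : ∀ n m → ∑[ i < n ] [ toℕ i ≡ᵇ m ] ≤ 1
∑-[toℕ≡ᵇ]≤1 zero    m       = z≤n
∑-[toℕ≡ᵇ]≤1 (suc n) zero    = ≤-reflexive (cong suc (sum-replicate-zero n))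
∑-[toℕ≡ᵇ]≤1 (suc n) (suc m) = ∑-[toℕ≡ᵇ]≤1 n m

∑-adjacent-pairs : ∀ n (f : Fin n → ℕ) h → (∀ i j → toℕ j ≡ suc (toℕ i) → h ≤ f i + f j) →
                   ⌊ n /2⌋ * h ≤ ∑[ i < n ] f i
∑-adjacent-pairs zero          f h pair = z≤n
∑-adjacent-pairs (suc zero)    f h pair = z≤n
∑-adjacent-pairs (suc (suc n)) f h pair = begin
  h + ⌊ n /2⌋ * h                    ≤⟨ +-mono-≤ (pair zero (suc zero) refl) rest ⟩
  f zero + f (suc zero) + ∑[ i < n ] f (suc (suc i)) ≡⟨ +-assoc (f zero) _ _ ⟩
  ∑[ i < suc (suc n) ] f i           ∎
  where
  open ≤-Reasoning
  rest = ∑-adjacent-pairs n (λ i → f (suc (suc i))) h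
           (λ i j j≡1+i → pair (suc (suc i)) (suc (suc j)) (cong (λ k → suc (suc k)) j≡1+i))

lookup-∁ : ∀ {n} (p : Subset n) i → lookup (∁ p) i ≡ not (lookup p i)
lookup-∁ (x ∷ p) zero    = refl
lookup-∁ (x ∷ p) (suc i) = lookup-∁ p i

∣p∣≡∑ : ∀ {n} (p : Subset n) → ∣ p ∣ ≡ ∑[ i < n ] [ lookup p i ]
∣p∣≡∑ []          = refl
∣p∣≡∑ (true ∷ p)  = cong suc (∣p∣≡∑ p)
∣p∣≡∑ (false ∷ p) = ∣p∣≡∑ p

∣tabulate∣ : ∀ {n} (f : Fin n → Bool) → ∣ tabulate f ∣ ≡ ∑[ i < n ] [ f i ]
∣tabulate∣ f = trans (∣p∣≡∑ (tabulate f)) (sum-cong-≗ (cong [_] ∘ lookup∘tabulate f))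

∣p∣+∣∁p∣≡n : ∀ {n} (p : Subset n) → ∣ p ∣ + ∣ ∁ p ∣ ≡ n
∣p∣+∣∁p∣≡n p = trans (cong (∣ p ∣ +_) (∣∁p∣≡n∸∣p∣ p)) (m+[n∸m]≡n (∣p∣≤n p))

0<∣p∣⇒Nonempty : ∀ {n} {p : Subset n} → 0 < ∣ p ∣ → Nonempty p
0<∣p∣⇒Nonempty {n} {p} 0<∣p∣ with nonempty? p
... | yes ne = ne
... | no  ¬ne =
  contradiction (subst (0 <_) (trans (cong ∣_∣ (Empty-unique ¬ne)) (∣⊥∣≡0 n)) 0<∣p∣) (<-irrefl refl)

tabulate-lookup-∁ : ∀ {m n} (S : Subset m) (g : Fin n → Fin m) →
                    tabulate (lookup (∁ S) ∘ g) ≡ ∁ (tabulate (lookup S ∘ g))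
tabulate-lookup-∁ S g = trans (tabulate-cong (lookup-∁ S ∘ g)) (tabulate-∘ not (lookup S ∘ g))

⌈n/2⌉≤m : ∀ {n m} → n ≤ m + m → ⌈ n /2⌉ ≤ m
⌈n/2⌉≤m {n} {m} n≤2m = ≤-trans (⌈n/2⌉-mono n≤2m) (≤-reflexive (sym (n≡⌈n+n/2⌉ m)))

∣p∣+∣q∣-cover : ∀ {n} (p q : Subset n) → (∀ i → lookup p i ∨ lookup q i ≡ true) → n ≤ ∣ p ∣ + ∣ q ∣
∣p∣+∣q∣-cover {n} p q cover = begin
  n                                                      ≡⟨ ∑-const-1 n ⟨
  ∑[ i < n ] 1
    ≤⟨ ∑-mono-≤ {n} (λ i → covered (lookup p i) (lookup q i) (cover i)) ⟩
  ∑[ i < n ] ([ lookup p i ] + [ lookup q i ])           ≡⟨ ∑-distrib-+ {n} _ _ ⟩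
  ∑[ i < n ] [ lookup p i ] + ∑[ i < n ] [ lookup q i ]  ≡⟨ cong₂ _+_ (∣p∣≡∑ p) (∣p∣≡∑ q) ⟨
  ∣ p ∣ + ∣ q ∣                                          ∎
  where
  open ≤-Reasoning
  covered : ∀ x y → x ∨ y ≡ true → 1 ≤ [ x ] + [ y ]
  covered true  y     _ = s≤s z≤n
  covered false true  _ = ≤-refl

degree : (G : Graph) → Fin (n G) → ℕ
degree G v = ∑[ u < n G ] [ adj G v u ]

δ≡∑ : ∀ G S v → δ G S v ≡ ∑[ u < n G ] [ lookup S u ∧ adj G v u ]
δ≡∑ G S v = trans (cong List.sum (map-tabulate {n = n G} (λ u → u) _)) (sum-tabulate (n G) _)

δ-tabulate : ∀ G (f : Fin (n G) → Bool) v → δ G (tabulate f) v ≡ ∑[ u < n G ] [ f u ∧ adj G v u ]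
δ-tabulate G f v =
  trans (δ≡∑ G (tabulate f) v) (sum-cong-≗ {n G} (λ u → cong (λ x → [ x ∧ adj G v u ]) (lookup∘tabulate f u)))

δ+δ∁≡degree : ∀ G S v → δ G S v + δ G (∁ S) v ≡ degree G v
δ+δ∁≡degree G S v = begin
  δ G S v + δ G (∁ S) v
    ≡⟨ cong₂ _+_ (δ≡∑ G S v)
                 (trans (δ≡∑ G (∁ S) v) (sum-cong-≗ (λ u → cong (λ x → [ x ∧ adj G v u ]) (lookup-∁ S u)))) ⟩
  ∑[ u < n G ] [ lookup S u ∧ adj G v u ] + ∑[ u < n G ] [ not (lookup S u) ∧ adj G v u ]
    ≡⟨ sym (∑-distrib-+ {n G} _ _) ⟩
  ∑[ u < n G ] ([ lookup S u ∧ adj G v u ] + [ not (lookup S u) ∧ adj G v u ])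
    ≡⟨ sum-cong-≗ (λ u → split (lookup S u) (adj G v u)) ⟩
  degree G v ∎
  where
  open ≡-Reasoning
  split : ∀ x y → [ x ∧ y ] + [ not x ∧ y ] ≡ [ y ]
  split true  y = +-identityʳ [ y ]
  split false y = refl

neighbour⇒1≤δ : ∀ G S v u → lookup S u ≡ true → adj G v u ≡ true → 1 ≤ δ G S v
neighbour⇒1≤δ G S v u u∈S v~u = begin
  1                                        ≡⟨ cong₂ (λ x y → [ x ∧ y ]) u∈S v~u ⟨
  [ lookup S u ∧ adj G v u ]               ≤⟨ f≤∑f _ u ⟩
  ∑[ w < n G ] [ lookup S w ∧ adj G v w ]  ≡⟨ δ≡∑ G S v ⟨
  δ G S v                                  ∎
  where open ≤-Reasoning

⊤-isGOA : ∀ G → Fin (n G) → IsGOA G ⊤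
⊤-isGOA G v = (v , ∈⊤) , λ u u∉⊤ → contradiction (trans (sym (lookup-replicate u true)) u∉⊤) λ ()

δ-K : ∀ {r} (T : Subset r) a → δ (K r) T a + [ lookup T a ] ≡ ∣ T ∣
δ-K {r} T a = begin
  δ (K r) T a + [ lookup T a ]
    ≡⟨ cong₂ _+_ (δ≡∑ (K r) T a) (sym (trans (∑-select (lookup T) (λ _ → true) a) (cong [_] (∧-identityʳ _)))) ⟩
  ∑[ u < r ] [ lookup T u ∧ not ⌊ a ≟ u ⌋ ] + ∑[ u < r ] [ lookup T u ∧ (⌊ a ≟ u ⌋ ∧ true) ]
    ≡⟨ sym (∑-distrib-+ {r} _ _) ⟩
  ∑[ u < r ] ([ lookup T u ∧ not ⌊ a ≟ u ⌋ ] + [ lookup T u ∧ (⌊ a ≟ u ⌋ ∧ true) ])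
    ≡⟨ sum-cong-≗ (λ u → split (lookup T u) ⌊ a ≟ u ⌋) ⟩
  ∑[ u < r ] [ lookup T u ]
    ≡⟨ ∣p∣≡∑ T ⟨
  ∣ T ∣ ∎
  where
  open ≡-Reasoning
  split : ∀ x e → [ x ∧ not e ] + [ x ∧ (e ∧ true) ] ≡ [ x ]
  split false e     = refl
  split true  false = refl
  split true  true  = refl

δ-K-∉ : ∀ {r} (T : Subset r) {a} → lookup T a ≡ false → δ (K r) T a ≡ ∣ T ∣
δ-K-∉ {r} T {a} a∉T = trans (sym (+-identityʳ _)) (subst (λ x → δ (K r) T a + [ x ] ≡ ∣ T ∣) a∉T (δ-K T a))

δ∁-K-∉ : ∀ {r} (T : Subset r) {a} → lookup T a ≡ false → δ (K r) (∁ T) a + 1 ≡ ∣ ∁ T ∣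
δ∁-K-∉ {r} T {a} a∉T =
  subst (λ x → δ (K r) (∁ T) a + [ x ] ≡ ∣ ∁ T ∣) (trans (lookup-∁ T a) (cong not a∉T)) (δ-K (∁ T) a)

K-isGOA : ∀ {r} {T : Subset r} → Nonempty T → ∣ ∁ T ∣ ≤ ∣ T ∣ → IsGOA (K r) T
K-isGOA {r} {T} nonempty ∣∁T∣≤∣T∣ = nonempty , λ v v∉T → begin
  δ (K r) (∁ T) v + 1  ≡⟨ δ∁-K-∉ T v∉T ⟩
  ∣ ∁ T ∣              ≤⟨ ∣∁T∣≤∣T∣ ⟩
  ∣ T ∣                ≡⟨ δ-K-∉ T v∉T ⟨
  δ (K r) T v          ∎
  where open ≤-Reasoning

initial : ∀ {n} → ℕ → Subset n
initial k = tabulate (λ i → toℕ i <ᵇ k)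

∣initial∣ : ∀ {n} k → k ≤ n → ∣ initial {n} k ∣ ≡ k
∣initial∣ {n} k k≤n = trans (∣tabulate∣ {n} _) (count n k k≤n)
  where
  count : ∀ n k → k ≤ n → ∑[ i < n ] [ toℕ i <ᵇ k ] ≡ k
  count zero    zero    _         = refl
  count (suc n) zero    _         = sum-replicate-zero (suc n)
  count (suc n) (suc k) (s≤s k≤n) = cong suc (count n k k≤n)

half-isGOA-K : ∀ {r} → 1 ≤ r → IsGOA (K r) (initial ⌈ r /2⌉)
half-isGOA-K {suc r} _ = K-isGOA (0<∣p∣⇒Nonempty (subst (0 <_) (sym ∣T∣≡) (s≤s z≤n))) (begin
  ∣ ∁ T ∣                                     ≡⟨ ∣∁p∣≡n∸∣p∣ T ⟩
  suc r ∸ ∣ T ∣                               ≡⟨ cong₂ _∸_ (sym (⌊n/2⌋+⌈n/2⌉≡n (suc r))) ∣T∣≡ ⟩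
  ⌊ suc r /2⌋ + ⌈ suc r /2⌉ ∸ ⌈ suc r /2⌉     ≡⟨ m+n∸n≡m ⌊ suc r /2⌋ ⌈ suc r /2⌉ ⟩
  ⌊ suc r /2⌋                                 ≤⟨ ⌊n/2⌋≤⌈n/2⌉ (suc r) ⟩
  ⌈ suc r /2⌉                                 ≡⟨ ∣T∣≡ ⟨
  ∣ T ∣                                       ∎)
  where
  open ≤-Reasoning
  T = initial {suc r} ⌈ suc r /2⌉
  ∣T∣≡ : ∣ T ∣ ≡ ⌈ suc r /2⌉
  ∣T∣≡ = ∣initial∣ _ (⌈n/2⌉≤n (suc r))

absDiff-suc : ∀ k → absDiff k (suc k) ≡ 1
absDiff-suc zero    = refl
absDiff-suc (suc k) = absDiff-suc k

P-adj-suc : ∀ {t} {v u : Fin t} → toℕ u ≡ suc (toℕ v) → adj (P t) v u ≡ true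
P-adj-suc {v = v} u≡1+v = cong (_≡ᵇ 1) (trans (cong (absDiff (toℕ v)) u≡1+v) (absDiff-suc (toℕ v)))

P-adj-pred : ∀ {t} {v u : Fin t} → toℕ v ≡ suc (toℕ u) → adj (P t) v u ≡ true
P-adj-pred {t} {v} {u} v≡1+u = trans (adj-sym (P t) v u) (P-adj-suc v≡1+u)

degree-P≤2 : ∀ {t} (v : Fin t) → degree (P t) v ≤ 2
degree-P≤2 {t} v = begin
  ∑[ u < t ] [ absDiff k (toℕ u) ≡ᵇ 1 ]
    ≤⟨ ∑-mono-≤ {t} (λ u → [absDiff≡ᵇ1]≤ k (toℕ u)) ⟩
  ∑[ u < t ] ([ toℕ u ≡ᵇ suc k ] + [ suc (toℕ u) ≡ᵇ k ])
    ≡⟨ ∑-distrib-+ {t} _ _ ⟩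
  ∑[ u < t ] [ toℕ u ≡ᵇ suc k ] + ∑[ u < t ] [ suc (toℕ u) ≡ᵇ k ]
    ≤⟨ +-mono-≤ (∑-[toℕ≡ᵇ]≤1 t (suc k)) (predecessors k) ⟩
  2 ∎
  where
  open ≤-Reasoning
  k = toℕ v
  [absDiff≡ᵇ1]≤ : ∀ k m → [ absDiff k m ≡ᵇ 1 ] ≤ [ m ≡ᵇ suc k ] + [ suc m ≡ᵇ k ]
  [absDiff≡ᵇ1]≤ zero          m       = m≤m+n _ _
  [absDiff≡ᵇ1]≤ (suc zero)    zero    = ≤-refl
  [absDiff≡ᵇ1]≤ (suc (suc k)) zero    = z≤n
  [absDiff≡ᵇ1]≤ (suc k)       (suc m) = [absDiff≡ᵇ1]≤ k m
  predecessors : ∀ k → ∑[ u < t ] [ suc (toℕ u) ≡ᵇ k ] ≤ 1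
  predecessors zero    = ≤-trans (≤-reflexive (sum-replicate-zero t)) z≤n
  predecessors (suc k) = ∑-[toℕ≡ᵇ]≤1 t k

odd : ℕ → Bool
odd zero    = false
odd (suc n) = not (odd n)

P-adj⇒odd-flips : ∀ {t} (v u : Fin t) → adj (P t) v u ≡ true → odd (toℕ u) ≡ not (odd (toℕ v))
P-adj⇒odd-flips v u = flips (toℕ v) (toℕ u)
  where
  flips : ∀ k m → (absDiff k m ≡ᵇ 1) ≡ true → odd m ≡ not (odd k)
  flips zero          (suc zero) _ = refl
  flips (suc zero)    zero       _ = refl
  flips (suc k)       (suc m)    e = cong not (flips k m e)

odds : ∀ t → Subset t
odds t = tabulate (odd ∘ toℕ)

∣odds∣ : ∀ t → ∣ odds t ∣ ≡ ⌊ t /2⌋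
∣odds∣ t = trans (∣tabulate∣ {t} _) (count t)
  where
  count : ∀ t → ∑[ i < t ] [ odd (toℕ i) ] ≡ ⌊ t /2⌋
  count zero          = refl
  count (suc zero)    = refl
  count (suc (suc t)) = cong suc (trans (sum-cong-≗ {t} (λ i → cong [_] (not-involutive (odd (toℕ i))))) (count t))

-- Every neighbour of an even vertex is odd, and every even vertex has one.
odds-isGOA : ∀ t → 2 ≤ t → IsGOA (P t) (odds t)
odds-isGOA (suc zero)      (s≤s ())
odds-isGOA t@(suc (suc _)) _ =
  0<∣p∣⇒Nonempty (subst (0 <_) (sym (∣odds∣ t)) (s≤s z≤n)) , λ v v∉O → begin
    δ (P t) (∁ (odds t)) v + 1   ≡⟨ cong (_+ 1) (no-odd-neighbour v (even v v∉O)) ⟩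
    1                            ≤⟨ odd-neighbour v (even v v∉O) ⟩
    δ (P t) (odds t) v           ∎
  where
  open ≤-Reasoning
  lookup-odds : ∀ u → lookup (odds t) u ≡ odd (toℕ u)
  lookup-odds = lookup∘tabulate (odd ∘ toℕ)
  even : ∀ v → lookup (odds t) v ≡ false → odd (toℕ v) ≡ false
  even v v∉O = trans (sym (lookup-odds v)) v∉O
  no-odd-neighbour : ∀ v → odd (toℕ v) ≡ false → δ (P t) (∁ (odds t)) v ≡ 0
  no-odd-neighbour v v-even = trans (δ≡∑ (P t) (∁ (odds t)) v) (trans (sum-cong-≗ {t} term≡0) (sum-replicate-zero t))
    where
    term≡0 : ∀ u → [ lookup (∁ (odds t)) u ∧ adj (P t) v u ] ≡ 0
    term≡0 u rewrite lookup-∁ (odds t) u | lookup-odds u with adj (P t) v u in v~u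
    ... | false = cong [_] (∧-zeroʳ _)
    ... | true  rewrite P-adj⇒odd-flips v u v~u | v-even = refl
  odd-neighbour : ∀ v → odd (toℕ v) ≡ false → 1 ≤ δ (P t) (odds t) v
  odd-neighbour zero    _      = neighbour⇒1≤δ (P t) (odds t) zero (suc zero) refl refl
  odd-neighbour (suc w) v-even = neighbour⇒1≤δ (P t) (odds t) (suc w) (inject₁ w)
    (trans (lookup-odds (inject₁ w)) (trans (cong odd (toℕ-inject₁ w))
      (trans (sym (not-involutive _)) (cong not v-even))))
    (P-adj-pred (cong suc (sym (toℕ-inject₁ w))))

module _ (G H : Graph) (S : Subset (n G * n H)) where

  row : Fin (n H) → Subset (n G)
  row b = tabulate (lookup S ∘ λ a → combine a b)

  column : Fin (n G) → Subset (n H)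
  column a = tabulate (lookup S ∘ combine a)

  ∣S∣≡∑∣row∣ : ∣ S ∣ ≡ ∑[ b < n H ] ∣ row b ∣
  ∣S∣≡∑∣row∣ = begin
    ∣ S ∣                                                 ≡⟨ ∣p∣≡∑ S ⟩
    ∑[ x < n G * n H ] [ lookup S x ]                     ≡⟨ ∑-combine (n G) _ ⟩
    ∑[ a < n G ] ∑[ b < n H ] [ lookup S (combine a b) ]  ≡⟨ ∑-comm {n G} {n H} _ ⟩
    ∑[ b < n H ] ∑[ a < n G ] [ lookup S (combine a b) ]
      ≡⟨ sum-cong-≗ {n H} (λ b → sym (∣tabulate∣ {n G} (λ a → lookup S (combine a b)))) ⟩
    ∑[ b < n H ] ∣ row b ∣                                ∎
    where open ≡-Reasoning

  δ-□ : ∀ a b → δ (G □ H) S (combine a b) ≡ δ H (column a) b + δ G (row b) a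
  δ-□ a b = begin
    δ (G □ H) S (combine a b)
      ≡⟨ δ≡∑ (G □ H) S (combine a b) ⟩
    ∑[ x < n G * n H ] [ lookup S x ∧ □adj G H (combine a b) x ]
      ≡⟨ ∑-combine (n G) _ ⟩
    ∑[ a′ < n G ] ∑[ b′ < n H ] [ σ a′ b′ ∧ □adj G H (combine a b) (combine a′ b′) ]
      ≡⟨ sum-cong-≗ {n G} (λ a′ → sum-cong-≗ {n H} (split a′)) ⟩
    ∑[ a′ < n G ] ∑[ b′ < n H ] ([ σ a′ b′ ∧ (⌊ a ≟ a′ ⌋ ∧ adj H b b′) ] + [ σ a′ b′ ∧ (⌊ b ≟ b′ ⌋ ∧ adj G a a′) ])
      ≡⟨ trans (sum-cong-≗ {n G} (λ a′ → ∑-distrib-+ {n H} _ _)) (∑-distrib-+ {n G} _ _) ⟩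
    ∑[ a′ < n G ] ∑[ b′ < n H ] [ σ a′ b′ ∧ (⌊ a ≟ a′ ⌋ ∧ adj H b b′) ]
      + ∑[ a′ < n G ] ∑[ b′ < n H ] [ σ a′ b′ ∧ (⌊ b ≟ b′ ⌋ ∧ adj G a a′) ]
      ≡⟨ cong₂ _+_ (trans (∑-comm {n G} {n H} _)
                          (sum-cong-≗ {n H} (λ b′ → ∑-select (λ a′ → σ a′ b′) (λ _ → adj H b b′) a)))
                   (sum-cong-≗ {n G} (λ a′ → ∑-select (σ a′) (λ _ → adj G a a′) b)) ⟩
    ∑[ b′ < n H ] [ σ a b′ ∧ adj H b b′ ] + ∑[ a′ < n G ] [ σ a′ b ∧ adj G a a′ ]
      ≡⟨ cong₂ _+_ (δ-tabulate H _ b) (δ-tabulate G _ a) ⟨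
    δ H (column a) b + δ G (row b) a ∎
    where
    open ≡-Reasoning
    σ : Fin (n G) → Fin (n H) → Bool
    σ a′ b′ = lookup S (combine a′ b′)
    [∧∨]-disjoint : ∀ s x y → (x ≡ true → y ≡ false) → [ s ∧ (x ∨ y) ] ≡ [ s ∧ x ] + [ s ∧ y ]
    [∧∨]-disjoint false x     y     _ = refl
    [∧∨]-disjoint true  true  y     x⇒¬y rewrite x⇒¬y refl = refl
    [∧∨]-disjoint true  false y     _ = refl
    -- The two kinds of edges of G □ H are disjoint since G has no loops.
    disjoint : ∀ a′ b′ → ⌊ a ≟ a′ ⌋ ∧ adj H b b′ ≡ true → adj G a a′ ∧ ⌊ b ≟ b′ ⌋ ≡ false
    disjoint a′ b′ e with a ≟ a′
    ... | yes refl rewrite irrefl G a = refl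
    disjoint a′ b′ () | no _
    split : ∀ a′ b′ → [ σ a′ b′ ∧ □adj G H (combine a b) (combine a′ b′) ]
                      ≡ [ σ a′ b′ ∧ (⌊ a ≟ a′ ⌋ ∧ adj H b b′) ] + [ σ a′ b′ ∧ (⌊ b ≟ b′ ⌋ ∧ adj G a a′) ]
    split a′ b′ = begin
      [ σ a′ b′ ∧ □adj G H (combine a b) (combine a′ b′) ]
        ≡⟨ cong₂ (λ p q → [ σ a′ b′ ∧ pAdj G H p q ]) (remQuot-combine a b) (remQuot-combine a′ b′) ⟩
      [ σ a′ b′ ∧ ((⌊ a ≟ a′ ⌋ ∧ adj H b b′) ∨ (adj G a a′ ∧ ⌊ b ≟ b′ ⌋)) ]
        ≡⟨ [∧∨]-disjoint (σ a′ b′) _ _ (disjoint a′ b′) ⟩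
      [ σ a′ b′ ∧ (⌊ a ≟ a′ ⌋ ∧ adj H b b′) ] + [ σ a′ b′ ∧ (adj G a a′ ∧ ⌊ b ≟ b′ ⌋) ]
        ≡⟨ cong (λ y → [ σ a′ b′ ∧ (⌊ a ≟ a′ ⌋ ∧ adj H b b′) ] + [ σ a′ b′ ∧ y ]) (∧-comm (adj G a a′) _) ⟩
      [ σ a′ b′ ∧ (⌊ a ≟ a′ ⌋ ∧ adj H b b′) ] + [ σ a′ b′ ∧ (⌊ b ≟ b′ ⌋ ∧ adj G a a′) ] ∎

δ∁-□ : ∀ G H S a b → δ (G □ H) (∁ S) (combine a b) ≡ δ H (∁ (column G H S a)) b + δ G (∁ (row G H S b)) a
δ∁-□ G H S a b = trans (δ-□ G H (∁ S) a b)
  (cong₂ (λ p q → δ H p b + δ G q a) (tabulate-lookup-∁ S (combine a)) (tabulate-lookup-∁ S (λ a′ → combine a′ b)))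

module _ {r} {H : Graph} {S : Subset (r * n H)} (S-isGOA : IsGOA (K r □ H) S) where

  row-dense : ∀ {a b} → lookup S (combine a b) ≡ false →
              δ H (column (K r) H S a) b ≤ δ H (∁ (column (K r) H S a)) b →
              r ≤ ∣ row (K r) H S b ∣ + ∣ row (K r) H S b ∣
  row-dense {a} {b} ab∉S x≤y = begin
    r                   ≡⟨ ∣p∣+∣∁p∣≡n R ⟨
    ∣ R ∣ + ∣ ∁ R ∣     ≤⟨ +-monoʳ-≤ ∣ R ∣ (+-cancelˡ-≤ y _ _ y+∣∁R∣≤y+∣R∣) ⟩
    ∣ R ∣ + ∣ R ∣       ∎
    where
    open ≤-Reasoning
    R = row (K r) H S b
    C = column (K r) H S a
    x = δ H C b
    y = δ H (∁ C) b
    a∉R : lookup R a ≡ false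
    a∉R = trans (lookup∘tabulate _ a) ab∉S
    y+∣∁R∣≤y+∣R∣ : y + ∣ ∁ R ∣ ≤ y + ∣ R ∣
    y+∣∁R∣≤y+∣R∣ = begin
      y + ∣ ∁ R ∣                               ≡⟨ cong (y +_) (δ∁-K-∉ R a∉R) ⟨
      y + (δ (K r) (∁ R) a + 1)                 ≡⟨ +-assoc y _ 1 ⟨
      y + δ (K r) (∁ R) a + 1                   ≡⟨ cong (_+ 1) (δ∁-□ (K r) H S a b) ⟨
      δ (K r □ H) (∁ S) (combine a b) + 1       ≤⟨ proj₂ S-isGOA (combine a b) ab∉S ⟩
      δ (K r □ H) S (combine a b)               ≡⟨ δ-□ (K r) H S a b ⟩
      x + δ (K r) R a                           ≡⟨ cong (x +_) (δ-K-∉ R a∉R) ⟩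
      x + ∣ R ∣                                 ≤⟨ +-monoˡ-≤ ∣ R ∣ x≤y ⟩
      y + ∣ R ∣                                 ∎

module _ {r t} {S : Subset (r * t)} (S-isGOA : IsGOA (K r □ P t) S) where

  private
    R : Fin t → Subset r
    R = row (K r) (P t) S

  adjacent-rows : ∀ b b′ → toℕ b′ ≡ suc (toℕ b) → ⌈ r /2⌉ ≤ ∣ R b ∣ + ∣ R b′ ∣
  adjacent-rows b b′ b′≡1+b
    with any? (λ a → (lookup S (combine a b) Bool.≟ false) ×-dec (lookup S (combine a b′) Bool.≟ false))
  ... | yes (a , ab∉S , ab′∉S) = ≤-trans (⌈n/2⌉≤m (row-dense {H = P t} S-isGOA ab∉S x≤y)) (m≤m+n ∣ R b ∣ ∣ R b′ ∣)
    where
    C = column (K r) (P t) S a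
    1≤y : 1 ≤ δ (P t) (∁ C) b
    1≤y = neighbour⇒1≤δ (P t) (∁ C) b b′ (trans (lookup-∁ C b′) (cong not (trans (lookup∘tabulate _ b′) ab′∉S)))
                                        (P-adj-suc b′≡1+b)
    x+y≤2 : δ (P t) C b + δ (P t) (∁ C) b ≤ 2
    x+y≤2 = ≤-trans (≤-reflexive (δ+δ∁≡degree (P t) C b)) (degree-P≤2 b)
    x≤y : δ (P t) C b ≤ δ (P t) (∁ C) b
    x≤y = ≤-trans (+-cancelʳ-≤ 1 _ 1 (≤-trans (+-monoʳ-≤ _ 1≤y) x+y≤2)) 1≤y
  ... | no ¬both∉S = ≤-trans (⌈n/2⌉≤n r) (∣p∣+∣q∣-cover (R b) (R b′) λ a →
          trans (cong₂ _∨_ (lookup∘tabulate _ a) (lookup∘tabulate _ a)) (∨-true _ _ (λ both → ¬both∉S (a , both))))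
    where
    ∨-true : ∀ x y → ¬ (x ≡ false × y ≡ false) → x ∨ y ≡ true
    ∨-true true  y     _     = refl
    ∨-true false true  _     = refl
    ∨-true false false ¬both = contradiction (refl , refl) ¬both

  ⌊t/2⌋*⌈r/2⌉≤∣S∣ : ⌊ t /2⌋ * ⌈ r /2⌉ ≤ ∣ S ∣
  ⌊t/2⌋*⌈r/2⌉≤∣S∣ = ≤-trans (∑-adjacent-pairs t (∣_∣ ∘ R) ⌈ r /2⌉ adjacent-rows)
                            (≤-reflexive (sym (∣S∣≡∑∣row∣ (K r) (P t) S)))

⌈r/2⌉≤∣S∣ : ∀ {r} {S : Subset (r * 1)} → IsGOA (K r □ P 1) S → ⌈ r /2⌉ ≤ ∣ S ∣
⌈r/2⌉≤∣S∣ {r} {S} S-isGOA = subst (⌈ r /2⌉ ≤_) ∣R₀∣≡∣S∣ (⌈n/2⌉≤m r≤2∣R₀∣)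
  where
  R₀ = row (K r) (P 1) S zero
  ∣R₀∣≡∣S∣ : ∣ R₀ ∣ ≡ ∣ S ∣
  ∣R₀∣≡∣S∣ = sym (trans (∣S∣≡∑∣row∣ (K r) (P 1) S) (+-identityʳ ∣ R₀ ∣))
  r≤2∣R₀∣ : r ≤ ∣ R₀ ∣ + ∣ R₀ ∣
  r≤2∣R₀∣ with any? (λ a → lookup S (combine a zero) Bool.≟ false)
  ... | yes (a , a0∉S) = row-dense {H = P 1} S-isGOA a0∉S x≤y
    where
    C = column (K r) (P 1) S a
    -- P 1 has no edges.
    x≤y : δ (P 1) C zero ≤ δ (P 1) (∁ C) zero
    x≤y = subst (_≤ δ (P 1) (∁ C) zero) (sym (m+n≡0⇒m≡0 _ (δ+δ∁≡degree (P 1) C zero))) z≤n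
  ... | no ¬a0∉S = ∣p∣+∣q∣-cover R₀ R₀ λ a →
    trans (∨-idem _) (trans (lookup∘tabulate _ a) (¬-not (λ a0∉S → ¬a0∉S (a , a0∉S))))

γo≤n : ∀ {G k} → Fin (n G) → IsGammaO G k → k ≤ n G
γo≤n {G} v (_ , minimal) = subst (_ ≤_) (∣⊤∣≡n (n G)) (minimal ⊤ (⊤-isGOA G v))

γo-K≤⌈r/2⌉ : ∀ {r k} → 1 ≤ r → IsGammaO (K r) k → k ≤ ⌈ r /2⌉
γo-K≤⌈r/2⌉ {r} 1≤r (_ , minimal) =
  subst (_ ≤_) (∣initial∣ ⌈ r /2⌉ (⌈n/2⌉≤n r)) (minimal (initial ⌈ r /2⌉) (half-isGOA-K 1≤r))

γo-P≤⌊t/2⌋ : ∀ {t k} → 2 ≤ t → IsGammaO (P t) k → k ≤ ⌊ t /2⌋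
γo-P≤⌊t/2⌋ {t} 2≤t (_ , minimal) = subst (_ ≤_) (∣odds∣ t) (minimal (odds t) (odds-isGOA t 2≤t))

corollary13 : ∀ (r t : ℕ) → 1 ≤ r → 1 ≤ t → ∀ (a b c : ℕ) →
    IsGammaO (K r) a → IsGammaO (P t) b → IsGammaO (K r □ P t) c →
    a * b ≤ c
corollary13 r (suc zero) 1≤r _ a b _ γK γP ((S , S-isGOA , refl) , _) = begin
  a * b            ≤⟨ *-mono-≤ (γo-K≤⌈r/2⌉ 1≤r γK) (γo≤n {P 1} zero γP) ⟩
  ⌈ r /2⌉ * 1      ≡⟨ *-identityʳ ⌈ r /2⌉ ⟩
  ⌈ r /2⌉          ≤⟨ ⌈r/2⌉≤∣S∣ S-isGOA ⟩
  ∣ S ∣            ∎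
  where open ≤-Reasoning
corollary13 r t@(suc (suc _)) 1≤r _ a b _ γK γP ((S , S-isGOA , refl) , _) = begin
  a * b              ≤⟨ *-mono-≤ (γo-K≤⌈r/2⌉ 1≤r γK) (γo-P≤⌊t/2⌋ (s≤s (s≤s z≤n)) γP) ⟩
  ⌈ r /2⌉ * ⌊ t /2⌋  ≡⟨ *-comm ⌈ r /2⌉ ⌊ t /2⌋ ⟩
  ⌊ t /2⌋ * ⌈ r /2⌉  ≤⟨ ⌊t/2⌋*⌈r/2⌉≤∣S∣ {r} {t} S-isGOA ⟩
  ∣ S ∣              ∎
  where open ≤-Reasoning
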